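{- Let $\Sigma$ be a finite alphabet. A hereditary class $\mathcal C\subseteq\Sigma^*$ of finite words is inexhaustible if and only if $\mathcal C$ is a union of inexhaustible ages.
   Context: $\Sigma^*$ is the set of finite words over $\Sigma$, ordered by the factor ordering ($v$ is a factor of $u$ if $u=u_1vu_2$). A subset of $\Sigma^*$ is hereditary if it contains every factor of each of its members. The age of a word $u$ (finite or infinite, on an interval of $\mathbb Z$) is the set $\mathrm{Fac}(u)$ of its finite factors. A nonempty subset $\mathcal C\subseteq\Sigma^*$ is inexhaustible if it is not reduced to the empty word and for every $v\in\mathcal C$ there is a word $w$ with $vwv\in\mathcal C$. -}

module Defs where

open import Data.Nat using (ℕ)
open import Data.Fin using (Fin; toℕ)
open import Data.Integer using (ℤ; _+_; +_; _≤_)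
open import Data.List using (List; []; _++_; length; lookup)
open import Data.Product using (Σ; ∃; _×_; _,_)
open import Relation.Binary.PropositionalEquality using (_≡_; _≢_)
open import Function.Bundles using (_⇔_)

Class : Set → Set₁
Class A = List A → Set

Factor : {A : Set} → List A → List A → Set
Factor {A} v u = Σ (List A) λ u₁ → Σ (List A) λ u₂ → u ≡ u₁ ++ v ++ u₂

Hereditary : {A : Set} → Class A → Set
Hereditary C = ∀ u v → C u → Factor v u → C v

Inexhaustible : {A : Set} → Class A → Set
Inexhaustible {A} C =
  (Σ (List A) λ v → C v × v ≢ [])
  × (∀ v → C v → Σ (List A) λ w → C (v ++ w ++ v))

-- A word (finite or infinite) indexed by an interval of ℤ (possibly empty or unbounded)
record IntervalWord (A : Set) : Set₁ where
  field
    Dom    : ℤ → Set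
    convex : ∀ {a b i} → Dom a → Dom b → a ≤ i → i ≤ b → Dom i
    letter : (z : ℤ) → Dom z → A

open IntervalWord public

-- the age of u: the set of its finite factors
Fac : {A : Set} → IntervalWord A → Class A
Fac u w = Σ ℤ λ k → (i : Fin (length w)) →
  Σ (Dom u (k + + toℕ i)) λ d → letter u (k + + toℕ i) d ≡ lookup w i

UnionOfInexhaustibleAges : {A : Set} → Class A → Set₁
UnionOfInexhaustibleAges {A} C =
  Σ Set λ I → I × Σ (I → IntervalWord A) λ u →
    (∀ i → Inexhaustible (Fac (u i)))
    × (∀ v → C v ⇔ (Σ I λ i → Fac (u i) v))

-- A union of inexhaustible classes is inexhaustible.  Conversely, every
-- nonempty v ∈ C seeds the sequence v₀ = v, vₖ₊₁ = vₖ wₖ vₖ of words of C,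
-- where wₖ is supplied by inexhaustibility.  Each vₖ is a prefix of vₖ₊₁, so
-- the vₖ converge to a right-infinite word x whose age consists of the
-- factors of the vₖ: it lies in C by heredity, contains v, and is
-- inexhaustible because a factor u of vₖ = a u b reappears as u (b wₖ a) u
-- in vₖ₊₁.  C is the union of these ages.
module Submission where

open import Defs
open import Data.Nat using (ℕ; zero; suc; _+_; _≤_; _<_; _≤′_; ≤′-refl; ≤′-step; z≤n; s≤s)
open import Data.Nat.Properties
  using (≤-trans; ≤-reflexive; ≤-total; ≤⇒≤′; +-monoʳ-≤; +-monoʳ-<; <-≤-trans; n≤1+n; m≤m+n; m≤n+m; m<m+n; module ≤-Reasoning)
open import Data.Fin using (Fin; toℕ)
open import Data.Fin.Properties using (toℕ<n)
open import Data.Integer using (+_; -[1+_]; +≤+)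
import Data.Integer as ℤ
open import Data.Integer.Properties using () renaming (≤-trans to ℤ-≤-trans)
open import Data.List using (List; []; _∷_; _++_; length; lookup)
open import Data.List.Properties using (length-++; ++-assoc; ++-identityʳ; ++-monoid)
open import Data.Product using (Σ; _×_; _,_; proj₁; proj₂)
open import Data.Sum using (inj₁; inj₂)
open import Data.Empty using (⊥-elim)
open import Function.Bundles using (mk⇔; Equivalence)
open import Relation.Binary.PropositionalEquality using (_≡_; _≢_; refl; sym; trans; cong; cong₂)
import Algebra.Solver.Monoid as MonoidSolver

module _ {A : Set} where

  at : A → List A → ℕ → A
  at d []       _       = d
  at d (x ∷ xs) zero    = x
  at d (x ∷ xs) (suc j) = at d xs j

  at-++ˡ : ∀ d (xs ys : List A) {j} → j < length xs → at d (xs ++ ys) j ≡ at d xs j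
  at-++ˡ d (x ∷ xs) ys {zero}  _       = refl
  at-++ˡ d (x ∷ xs) ys {suc j} (s≤s p) = at-++ˡ d xs ys p

  at-++ʳ : ∀ d (xs ys : List A) j → at d (xs ++ ys) (length xs + j) ≡ at d ys j
  at-++ʳ d []       ys j = refl
  at-++ʳ d (x ∷ xs) ys j = at-++ʳ d xs ys j

  lookup≡at : ∀ d (xs : List A) (i : Fin (length xs)) → lookup xs i ≡ at d xs (toℕ i)
  lookup≡at d (x ∷ xs) Fin.zero    = refl
  lookup≡at d (x ∷ xs) (Fin.suc i) = lookup≡at d xs i

  OccursAt : A → List A → List A → ℕ → Set
  OccursAt d w xs p =
    p + length w ≤ length xs × ((i : Fin (length w)) → at d xs (p + toℕ i) ≡ lookup w i)

  factor⇒occursAt : ∀ d {w xs : List A} a b → xs ≡ a ++ w ++ b → OccursAt d w xs (length a)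
  factor⇒occursAt d {w} a b refl = bound , letters
    where
    bound : length a + length w ≤ length (a ++ w ++ b)
    bound = ≤-trans (+-monoʳ-≤ (length a) (≤-trans (m≤m+n (length w) (length b))
                      (≤-reflexive (sym (length-++ w)))))
                    (≤-reflexive (sym (length-++ a)))
    letters : (i : Fin (length w)) → at d (a ++ w ++ b) (length a + toℕ i) ≡ lookup w i
    letters i = trans (at-++ʳ d a (w ++ b) (toℕ i))
                  (trans (at-++ˡ d w b (toℕ<n i)) (sym (lookup≡at d w i)))

  occursAt-0⇒prefix : ∀ d (w xs : List A) → OccursAt d w xs 0 → Σ (List A) λ b → xs ≡ w ++ b
  occursAt-0⇒prefix d []      xs       _                      = xs , refl
  occursAt-0⇒prefix d (y ∷ w) (x ∷ xs) (s≤s bound , letters)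
    with occursAt-0⇒prefix d w xs (bound , λ i → letters (Fin.suc i))
  ... | b , eq = b , cong₂ _∷_ (letters Fin.zero) eq

  occursAt⇒factor : ∀ d {w xs : List A} p → OccursAt d w xs p → Factor w xs
  occursAt⇒factor d {w} {xs} zero occ with occursAt-0⇒prefix d w xs occ
  ... | b , eq = [] , b , eq
  occursAt⇒factor d {w} {x ∷ xs} (suc p) (s≤s bound , letters)
    with occursAt⇒factor d p (bound , letters)
  ... | a , b , eq = x ∷ a , b , cong (x ∷_) eq

  factor-repeats : ∀ {w u : List A} → Factor w u →
    ∀ g → Σ (List A) λ h → Factor (w ++ h ++ w) (u ++ g ++ u)
  factor-repeats {w} (a , b , refl) g = b ++ g ++ a , a , b , rearrange a w b g
    where
    open MonoidSolver (++-monoid A)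
    rearrange : ∀ (a w b g : List A) →
      (a ++ w ++ b) ++ g ++ (a ++ w ++ b) ≡ a ++ (w ++ (b ++ g ++ a) ++ w) ++ b
    rearrange = solve 4 (λ a w b g →
      (a ⊕ w ⊕ b) ⊕ g ⊕ (a ⊕ w ⊕ b) ⊜ a ⊕ (w ⊕ (b ⊕ g ⊕ a) ⊕ w) ⊕ b) refl

module Doubling {A : Set} (C : Class A) (hered : Hereditary C)
  (extend : ∀ v → C v → Σ (List A) λ w → C (v ++ w ++ v))
  (a : A) (v′ : List A) (Cv : C (a ∷ v′)) where

  -- The seed a ∷ v′ is nonempty; its first letter a doubles as the default letter of at.

  double : Σ (List A) C → Σ (List A) C
  double (u , Cu) = u ++ proj₁ (extend u Cu) ++ u , proj₂ (extend u Cu)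

  approx : ℕ → Σ (List A) C
  approx zero    = a ∷ v′ , Cv
  approx (suc k) = double (approx k)

  word : ℕ → List A
  word k = proj₁ (approx k)

  gap : ℕ → List A
  gap k = proj₁ (extend (word k) (proj₂ (approx k)))

  k<length-word : ∀ k → k < length (word k)
  k<length-word zero    = s≤s z≤n
  k<length-word (suc k) = begin-strict
    suc k                                      ≤⟨ k<length-word k ⟩
    length (word k)                            <⟨ m<m+n (length (word k)) gap++word-nonempty ⟩
    length (word k) + length (gap k ++ word k) ≡⟨ length-++ (word k) ⟨
    length (word (suc k))                      ∎
    where
    open ≤-Reasoning
    gap++word-nonempty : 0 < length (gap k ++ word k)
    gap++word-nonempty = begin-strict
      0                                ≤⟨ z≤n ⟩
      k                                <⟨ k<length-word k ⟩
      length (word k)                  ≤⟨ m≤n+m (length (word k)) (length (gap k)) ⟩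
      length (gap k) + length (word k) ≡⟨ length-++ (gap k) ⟨
      length (gap k ++ word k)         ∎

  word-prefix : ∀ {k m} → k ≤′ m → Σ (List A) λ t → word m ≡ word k ++ t
  word-prefix {k} ≤′-refl = [] , sym (++-identityʳ (word k))
  word-prefix {k} (≤′-step {m} k≤′m) with word-prefix k≤′m
  ... | t , eq = t ++ gap m ++ word m , trans (cong (_++ gap m ++ word m) eq) (++-assoc (word k) t _)

  at-word-stable : ∀ {k m j} → k ≤ m → j < length (word k) → at a (word m) j ≡ at a (word k) j
  at-word-stable {k} k≤m j<len with word-prefix (≤⇒≤′ k≤m)
  ... | t , eq = trans (cong (λ u → at a u _) eq) (at-++ˡ a (word k) t j<len)

  -- The j-th letter of the limit is read off word j, which is long enough.
  limit : ℕ → A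
  limit j = at a (word j) j

  limit-agrees : ∀ {j} M → j < length (word M) → limit j ≡ at a (word M) j
  limit-agrees {j} M j<len with ≤-total j M
  ... | inj₁ j≤M = sym (at-word-stable j≤M (k<length-word j))
  ... | inj₂ M≤j = at-word-stable M≤j j<len

  limitWord : IntervalWord A
  limitWord = record
    { Dom    = λ z → + 0 ℤ.≤ z
    ; convex = λ 0≤a _ a≤i _ → ℤ-≤-trans 0≤a a≤i
    ; letter = λ z _ → limit ℤ.∣ z ∣
    }

  factor⇒age : ∀ {w} M → Factor w (word M) → Fac limitWord w
  factor⇒age M (b₁ , b₂ , eq) with factor⇒occursAt a b₁ b₂ eq
  ... | bound , letters = + length b₁ , λ i → +≤+ z≤n ,
    trans (limit-agrees M (<-≤-trans (+-monoʳ-< (length b₁) (toℕ<n i)) bound)) (letters i)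

  age⇒factor : ∀ w → Fac limitWord w → Σ ℕ λ N → Factor w (word N)
  age⇒factor []      _              = 0 , [] , word 0 , refl
  -- A nonempty factor cannot start at a negative position, which lies outside Dom.
  age⇒factor (y ∷ w) (-[1+ p ] , h) with proj₁ (h Fin.zero)
  ... | ()
  age⇒factor (y ∷ w) (+ p , h)      = N , occursAt⇒factor a p (bound , letters)
    where
    N = p + length (y ∷ w)
    bound : N ≤ length (word N)
    bound = ≤-trans (n≤1+n N) (k<length-word N)
    letters : (i : Fin (length (y ∷ w))) → at a (word N) (p + toℕ i) ≡ lookup (y ∷ w) i
    letters i = trans (sym (limit-agrees N (<-≤-trans (+-monoʳ-< p (toℕ<n i)) bound))) (proj₂ (h i))

  age⊆C : ∀ w → Fac limitWord w → C w
  age⊆C w fw with age⇒factor w fw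
  ... | N , factor = hered _ w (proj₂ (approx N)) factor

  seed∈age : Fac limitWord (a ∷ v′)
  seed∈age = factor⇒age 0 ([] , [] , sym (++-identityʳ (a ∷ v′)))

  age-inexhaustible : Inexhaustible (Fac limitWord)
  age-inexhaustible = (a ∷ v′ , seed∈age , λ ()) , repeat
    where
    repeat : ∀ w → Fac limitWord w → Σ (List A) λ h → Fac limitWord (w ++ h ++ w)
    repeat w fw with age⇒factor w fw
    ... | N , factor with factor-repeats factor (gap N)
    ...   | h , factor′ = h , factor⇒age (suc N) factor′

union⇒inexhaustible : ∀ {A : Set} {C : Class A} → UnionOfInexhaustibleAges C → Inexhaustible C
union⇒inexhaustible {A} {C} (I , i₀ , u , inexh , C⇔⋃) = nonempty (proj₁ (inexh i₀)) , repeat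
  where
  open Equivalence
  ⋃⊆C : ∀ {w} → Σ I (λ i → Fac (u i) w) → C w
  ⋃⊆C = from (C⇔⋃ _)
  nonempty : Σ (List A) (λ v → Fac (u i₀) v × v ≢ []) → Σ (List A) λ v → C v × v ≢ []
  nonempty (v , v∈u₀ , v≢[]) = v , ⋃⊆C (i₀ , v∈u₀) , v≢[]
  repeat : ∀ w → C w → Σ (List A) λ h → C (w ++ h ++ w)
  repeat w Cw with to (C⇔⋃ w) Cw
  ... | i , w∈uᵢ with proj₂ (inexh i) w w∈uᵢ
  ...   | h , www∈uᵢ = h , ⋃⊆C (i , www∈uᵢ)

inexhaustible⇒union : ∀ {A : Set} {C : Class A} →
  Hereditary C → Inexhaustible C → UnionOfInexhaustibleAges C
inexhaustible⇒union {A} {C} hered ((v , Cv , v≢[]) , extend) =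
  Seed , asSeed v v≢[] Cv , age , (λ s → Limit.age-inexhaustible s) , λ w → mk⇔ (C⊆⋃ w) (⋃⊆C w)
  where
  Seed : Set
  Seed = Σ A λ a → Σ (List A) λ v′ → C (a ∷ v′)
  asSeed : ∀ v → v ≢ [] → C v → Seed
  asSeed []       v≢[] _  = ⊥-elim (v≢[] refl)
  asSeed (a ∷ v′) _    Cv = a , v′ , Cv
  module Limit (s : Seed) = Doubling C hered extend (proj₁ s) (proj₁ (proj₂ s)) (proj₂ (proj₂ s))
  age : Seed → IntervalWord A
  age s = Limit.limitWord s
  C⊆⋃ : ∀ w → C w → Σ Seed λ s → Fac (age s) w
  C⊆⋃ []       _  = asSeed v v≢[] Cv , + 0 , λ ()
  C⊆⋃ (a ∷ w′) Cw = (a , w′ , Cw) , Limit.seed∈age (a , w′ , Cw)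
  ⋃⊆C : ∀ w → Σ Seed (λ s → Fac (age s) w) → C w
  ⋃⊆C w (s , w∈age) = Limit.age⊆C s w w∈age

mainTheorem17 : (n : ℕ) (C : Class (Fin n)) → Hereditary C →
    (Inexhaustible C → UnionOfInexhaustibleAges C)
    × (UnionOfInexhaustibleAges C → Inexhaustible C)
mainTheorem17 n C hered = inexhaustible⇒union hered , union⇒inexhaustible
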